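{- Let $\mathbf{A}$ be an $\mathrm{FL}_\mathrm{e}$-algebra. Then every m-$\mathcal{L}_s$-lattice $\langle\mathbf{A},\Box,\Diamond\rangle$ satisfies the equations \[ \Box(x\to\Box y)\approx\Diamond x\to\Box y\qquad\text{and}\qquad \Box(\Box x\to y)\approx\Box x\to\Box y. \]
   Context: $\mathcal{L}_s$ is the signature with binary $\lor,\land,\cdot,\to$ and constants $\mathrm{f},\mathrm{e}$. An $\mathrm{FL}_\mathrm{e}$-algebra is an algebra $\langle A,\lor,\land,\cdot,\to,\mathrm{f},\mathrm{e}\rangle$ such that $\langle A,\land,\lor\rangle$ is a lattice (order $\le$), $\langle A,\cdot,\mathrm{e}\rangle$ is a commutative monoid, and $a\cdot b\le c\iff a\le b\to c$ for all $a,b,c$. An m-$\mathcal{L}_s$-lattice is $\langle\mathbf{A},\Box,\Diamond\rangle$ with $\mathbf{A}$ an $\mathcal{L}_s$-algebra whose $\{\land,\lor\}$-reduct is a lattice, and unary $\Box,\Diamond$ satisfying $\Box x\land x\approx\Box x$, $\Diamond x\lor x\approx \Diamond x$, $\Box(x\land y)\approx\Box x\land\Box y$, $\Diamond(x\lor y)\approx\Diamond x\lor\Diamond y$, $\Box\Diamond x\approx\Diamond x$, $\Diamond\Box x\approx\Box x$, and $\Box(\star(\Box x_1,\dots,\Box x_n))\approx\star(\Box x_1,\dots,\Box x_n)$ for every $n$-ary symbol $\star\in\mathcal{L}_s$ (including the constants, $n=0$). -}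

module Defs where

open import Level using (Level; suc; _⊔_)
open import Relation.Binary.PropositionalEquality using (_≡_)
open import Algebra.Lattice.Structures using (IsLattice)
open import Algebra.Structures using (IsCommutativeMonoid)
open import Function.Bundles using (_⇔_)

record FLeAlgebra (a : Level) : Set (suc a) where
  infixr 6 _∨_
  infixr 7 _∧_
  infixr 8 _·_
  infixr 5 _⇒_
  infix 4 _≤_
  field
    Carrier : Set a
    _∨_ _∧_ _·_ _⇒_ : Carrier → Carrier → Carrier
    f e : Carrier
    isLattice : IsLattice _≡_ _∨_ _∧_
    isCommutativeMonoid : IsCommutativeMonoid _≡_ _·_ e

  _≤_ : Carrier → Carrier → Set a
  x ≤ y = x ∧ y ≡ x

  field
    residuation : ∀ x y z → (x · y ≤ z) ⇔ (x ≤ y ⇒ z)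

record MLattice {a : Level} (A : FLeAlgebra a) : Set a where
  open FLeAlgebra A
  field
    □ ◇ : Carrier → Carrier
    □-deflationary : ∀ x → □ x ∧ x ≡ □ x
    ◇-inflationary : ∀ x → ◇ x ∨ x ≡ ◇ x
    □-∧ : ∀ x y → □ (x ∧ y) ≡ □ x ∧ □ y
    ◇-∨ : ∀ x y → ◇ (x ∨ y) ≡ ◇ x ∨ ◇ y
    □◇ : ∀ x → □ (◇ x) ≡ ◇ x
    ◇□ : ∀ x → ◇ (□ x) ≡ □ x
    -- □(★(□x₁,…,□xₙ)) ≈ ★(□x₁,…,□xₙ) for every ★ ∈ L_s
    □-∨ : ∀ x y → □ (□ x ∨ □ y) ≡ □ x ∨ □ y
    □-∧□ : ∀ x y → □ (□ x ∧ □ y) ≡ □ x ∧ □ y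
    □-· : ∀ x y → □ (□ x · □ y) ≡ □ x · □ y
    □-⇒ : ∀ x y → □ (□ x ⇒ □ y) ≡ □ x ⇒ □ y
    □-f : □ f ≡ f
    □-e : □ e ≡ e

{-# OPTIONS --safe #-}
-- □ is an interior operator whose fixed points, the open elements, are closed
-- under the operations of L_s and coincide with the fixed points of ◇. So for
-- open u, u ≤ z gives u ≤ □ z and z ≤ u gives ◇ z ≤ u. Both equations then
-- follow by residuation, since every implication between open elements is open.
module Submission where

open import Defs
open import Level using (Level)
open import Data.Product using (_×_; _,_)
open import Relation.Binary.PropositionalEquality
  using (_≡_; sym; trans; cong; cong₂; subst; module ≡-Reasoning)
open import Function.Bundles using (Equivalence)
open import Algebra.Lattice.Bundles using (Lattice)
open import Algebra.Lattice.Structures using (IsLattice)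
open import Algebra.Structures using (IsCommutativeMonoid)
import Algebra.Lattice.Properties.Lattice as LatticeProperties
open import Relation.Binary.Bundles using (Poset)

module FLeProperties {a : Level} (A : FLeAlgebra a) where
  open FLeAlgebra A
  open IsLattice isLattice using (∨-comm; ∧-comm; ∨-absorbs-∧; ∧-absorbs-∨)
  open IsCommutativeMonoid isCommutativeMonoid using () renaming (comm to ·-comm)

  lattice : Lattice a a
  lattice = record { isLattice = isLattice }

  open LatticeProperties lattice using (∧-idem; poset)

  -- Defs orders by x ∧ y ≡ x, the library's natural order by x ≡ x ∧ y.
  ≤-refl : ∀ {x} → x ≤ x
  ≤-refl {x} = ∧-idem x

  ≤-trans : ∀ {x y z} → x ≤ y → y ≤ z → x ≤ z
  ≤-trans p q = sym (Poset.trans poset (sym p) (sym q))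

  ≤-antisym : ∀ {x y} → x ≤ y → y ≤ x → x ≡ y
  ≤-antisym p q = Poset.antisym poset (sym p) (sym q)

  y≤x∨y : ∀ x y → y ≤ x ∨ y
  y≤x∨y x y = trans (cong (y ∧_) (∨-comm x y)) (∧-absorbs-∨ y x)

  ≤⇒∨≡ : ∀ {x y} → x ≤ y → x ∨ y ≡ y
  ≤⇒∨≡ {x} {y} x≤y = begin
    x ∨ y        ≡⟨ cong (_∨ y) (trans (sym x≤y) (∧-comm x y)) ⟩
    y ∧ x ∨ y    ≡⟨ ∨-comm (y ∧ x) y ⟩
    y ∨ y ∧ x    ≡⟨ ∨-absorbs-∧ y x ⟩
    y            ∎
    where open ≡-Reasoning

  residual : ∀ {x y z} → x · y ≤ z → x ≤ y ⇒ z
  residual {x} {y} {z} = Equivalence.to (residuation x y z)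

  residual⁻¹ : ∀ {x y z} → x ≤ y ⇒ z → x · y ≤ z
  residual⁻¹ {x} {y} {z} = Equivalence.from (residuation x y z)

  residualˡ : ∀ {x y z} → x · y ≤ z → y ≤ x ⇒ z
  residualˡ {x} {y} {z} p = residual (subst (_≤ z) (·-comm x y) p)

  residualˡ⁻¹ : ∀ {x y z} → y ≤ x ⇒ z → x · y ≤ z
  residualˡ⁻¹ {x} {y} {z} p = subst (_≤ z) (·-comm y x) (residual⁻¹ p)

  ⇒-eval : ∀ x y → (x ⇒ y) · x ≤ y
  ⇒-eval x y = residual⁻¹ ≤-refl

  ·-monoʳ-≤ : ∀ {u x y} → x ≤ y → u · x ≤ u · y
  ·-monoʳ-≤ x≤y = residualˡ⁻¹ (≤-trans x≤y (residualˡ ≤-refl))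

  ⇒-antitoneˡ : ∀ {x y z} → x ≤ y → y ⇒ z ≤ x ⇒ z
  ⇒-antitoneˡ {y = y} {z} x≤y = residual (≤-trans (·-monoʳ-≤ x≤y) (⇒-eval y z))

  ⇒-monoʳ-≤ : ∀ {x y z} → y ≤ z → x ⇒ y ≤ x ⇒ z
  ⇒-monoʳ-≤ {x} {y} y≤z = residual (≤-trans (⇒-eval x y) y≤z)

module MLatticeProperties {a : Level} (A : FLeAlgebra a) (M : MLattice A) where
  open FLeAlgebra A
  open MLattice M
  open FLeProperties A

  IsOpen : Carrier → Set a
  IsOpen u = □ u ≡ u

  □-open : ∀ x → IsOpen (□ x)
  □-open x = begin
    □ (□ x)      ≡⟨ cong □ (sym (◇□ x)) ⟩
    □ (◇ (□ x))  ≡⟨ □◇ (□ x) ⟩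
    ◇ (□ x)      ≡⟨ ◇□ x ⟩
    □ x          ∎
    where open ≡-Reasoning

  ◇-open : ∀ x → IsOpen (◇ x)
  ◇-open = □◇

  ·-open : ∀ {u v} → IsOpen u → IsOpen v → IsOpen (u · v)
  ·-open {u} {v} u° v° = begin
    □ (u · v)      ≡⟨ cong □ (sym (cong₂ _·_ u° v°)) ⟩
    □ (□ u · □ v)  ≡⟨ □-· u v ⟩
    □ u · □ v      ≡⟨ cong₂ _·_ u° v° ⟩
    u · v          ∎
    where open ≡-Reasoning

  ⇒-open : ∀ {u v} → IsOpen u → IsOpen v → IsOpen (u ⇒ v)
  ⇒-open {u} {v} u° v° = begin
    □ (u ⇒ v)      ≡⟨ cong □ (sym (cong₂ _⇒_ u° v°)) ⟩
    □ (□ u ⇒ □ v)  ≡⟨ □-⇒ u v ⟩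
    □ u ⇒ □ v      ≡⟨ cong₂ _⇒_ u° v° ⟩
    u ⇒ v          ∎
    where open ≡-Reasoning

  ◇-fixes-open : ∀ {u} → IsOpen u → ◇ u ≡ u
  ◇-fixes-open {u} u° = trans (cong ◇ (sym u°)) (trans (◇□ u) u°)

  □-mono-≤ : ∀ {x y} → x ≤ y → □ x ≤ □ y
  □-mono-≤ {x} {y} x≤y = trans (sym (□-∧ x y)) (cong □ x≤y)

  ◇-mono-≤ : ∀ {x y} → x ≤ y → ◇ x ≤ ◇ y
  ◇-mono-≤ {x} {y} x≤y = begin
    ◇ x ∧ ◇ y          ≡⟨ cong (λ t → ◇ x ∧ ◇ t) (sym (≤⇒∨≡ x≤y)) ⟩
    ◇ x ∧ ◇ (x ∨ y)    ≡⟨ cong (◇ x ∧_) (◇-∨ x y) ⟩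
    ◇ x ∧ (◇ x ∨ ◇ y)  ≡⟨ ∧-absorbs-∨ (◇ x) (◇ y) ⟩
    ◇ x                ∎
    where
    open ≡-Reasoning
    open IsLattice isLattice using (∧-absorbs-∨)

  x≤◇x : ∀ x → x ≤ ◇ x
  x≤◇x x = subst (x ≤_) (◇-inflationary x) (y≤x∨y (◇ x) x)

  open-≤-□ : ∀ {u z} → IsOpen u → u ≤ z → u ≤ □ z
  open-≤-□ u° u≤z = subst (_≤ □ _) u° (□-mono-≤ u≤z)

  ◇-≤-open : ∀ {z u} → IsOpen u → z ≤ u → ◇ z ≤ u
  ◇-≤-open u° z≤u = subst (◇ _ ≤_) (◇-fixes-open u°) (◇-mono-≤ z≤u)

  □-⇒-□ʳ : ∀ x y → □ (x ⇒ □ y) ≡ ◇ x ⇒ □ y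
  □-⇒-□ʳ x y = ≤-antisym (residual (residualˡ⁻¹ ◇x≤w⇒□y)) ◇x⇒□y≤w
    where
    w : Carrier
    w = □ (x ⇒ □ y)

    ◇x≤w⇒□y : ◇ x ≤ w ⇒ □ y
    ◇x≤w⇒□y = ◇-≤-open (⇒-open (□-open (x ⇒ □ y)) (□-open y))
                (residualˡ (residual⁻¹ (□-deflationary (x ⇒ □ y))))

    ◇x⇒□y≤w : ◇ x ⇒ □ y ≤ w
    ◇x⇒□y≤w = open-≤-□ (⇒-open (◇-open x) (□-open y)) (⇒-antitoneˡ (x≤◇x x))

  □-□⇒ : ∀ x y → □ (□ x ⇒ y) ≡ □ x ⇒ □ y
  □-□⇒ x y = ≤-antisym (residual w·□x≤□y) □x⇒□y≤w
    where
    w : Carrier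
    w = □ (□ x ⇒ y)

    w·□x≤□y : w · □ x ≤ □ y
    w·□x≤□y = open-≤-□ (·-open (□-open (□ x ⇒ y)) (□-open x))
                (residual⁻¹ (□-deflationary (□ x ⇒ y)))

    □x⇒□y≤w : □ x ⇒ □ y ≤ w
    □x⇒□y≤w = open-≤-□ (⇒-open (□-open x) (□-open y)) (⇒-monoʳ-≤ (□-deflationary y))

proposition5p1 : {a : Level} (A : FLeAlgebra a) (M : MLattice A) →
                 let open FLeAlgebra A in
                 let open MLattice M in
                 (∀ x y → □ (x ⇒ □ y) ≡ (◇ x ⇒ □ y))
                 × (∀ x y → □ (□ x ⇒ y) ≡ (□ x ⇒ □ y))
proposition5p1 A M = □-⇒-□ʳ , □-□⇒
  where open MLatticeProperties A M
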